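{- Let $\mathcal{C}$ be an $n$-step staircase with maximum point $(x_{\max},y_{\max},z_{\max})$ (the coordinatewise maxima over $\mathcal{C}$). Let $\mathcal{B}_Z$, $\mathcal{B}_X$, $\mathcal{B}_Y$ be the sequences returned by the boundary tracing algorithm started at $(x_{\max},y_{\max},z_{\max})$ with search orders $(x,y,z)$, $(y,z,x)$, $(z,x,y)$ respectively. Then $\mathcal{C}=\mathcal{B}_X\vee\mathcal{B}_Y\vee\mathcal{B}_Z:=\{A_1\cup A_2\cup A_3: A_1\in\mathcal{B}_X,\ A_2\in\mathcal{B}_Y,\ A_3\in\mathcal{B}_Z\}$.
   Context: Points of $\mathbb{Z}^3$ are regarded as multisets over $\{x,y,z\}$; $A\cup B$ is the coordinatewise maximum. A digital cuboid is a set $C=\{(x,y,z)\in\mathbb{Z}^3: x_{\min}\le x\le x_{\max},\ y_{\min}\le y\le y_{\max},\ z_{\min}\le z\le z_{\max}\}$ with $|C|>1$. A sequence of cuboids $C_1,\dots,C_n$ (with parameters $x^i_{\min},x^i_{\max}$, etc.) is regular if (a) $x^1_{\min}=y^1_{\min}=z^1_{\min}=0$; (b) for each $1\le i\le n-1$: $x^i_{\min}\le x^{i+1}_{\min}$, $y^i_{\min}\le y^{i+1}_{\min}$, $z^i_{\min}\le z^{i+1}_{\min}$, at least one strict; (c) for each $1\le i\le n-1$: $x^{i+1}_{\min}\le x^i_{\max}$, $y^{i+1}_{\min}\le y^i_{\max}$, $z^{i+1}_{\min}\le z^i_{\max}$; (d) for each $1\le i\le n-1$: $x^i_{\max}\le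 x^{i+1}_{\max}$, $y^i_{\max}\le y^{i+1}_{\max}$, $z^i_{\max}\le z^{i+1}_{\max}$, at least one strict. The union $\mathcal{C}=C_1\cup\dots\cup C_n$ of a regular sequence is an $n$-step staircase. Boundary tracing algorithm with search order $(u,v,w)$ (a permutation of the coordinates $x,y,z$) started at a point $P\in\mathcal{C}$: set the current point to $P$ and record it as $B_0$; repeat: if decreasing coordinate $u$ by $1$ gives a point of $\mathcal{C}$, decrease $u$; else if decreasing $v$ by $1$ gives a point of $\mathcal{C}$, decrease $v$; else decrease $w$ by $1$; record the new point as $B_{i}$ (with $i$ incremented); stop when $B_i=(0,0,0)$. The output is the sequence $B_i,B_{i-1},\dots,B_0$. -}

module Defs where

open import Data.Integer using (ℤ; _≤_; _<_; _-_; _⊔_; 0ℤ; 1ℤ)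
open import Data.Product using (_×_; _,_; ∃; Σ)
open import Data.Sum using (_⊎_)
open import Data.List using (List; []; _∷_)
open import Data.List.Relation.Unary.Any using (Any)
open import Data.List.Relation.Unary.All using (All)
open import Data.List.Membership.Propositional using (_∈_)
open import Data.Unit using (⊤)
open import Data.Empty using (⊥)
open import Relation.Nullary using (¬_)
open import Relation.Binary.PropositionalEquality using (_≡_)

Point : Set
Point = ℤ × ℤ × ℤ

px py pz : Point → ℤ
px (x , _ , _) = x
py (_ , y , _) = y
pz (_ , _ , z) = z

origin : Point
origin = (0ℤ , 0ℤ , 0ℤ)

-- union of points regarded as multisets = coordinatewise maximum
_∪ₚ_ : Point → Point → Point
(x , y , z) ∪ₚ (x' , y' , z') = (x ⊔ x' , y ⊔ y' , z ⊔ z')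

data Coord : Set where
  X Y Z : Coord

coord : Coord → Point → ℤ
coord X = px
coord Y = py
coord Z = pz

dec : Coord → Point → Point
dec X (x , y , z) = (x - 1ℤ , y , z)
dec Y (x , y , z) = (x , y - 1ℤ , z)
dec Z (x , y , z) = (x , y , z - 1ℤ)

record Cuboid : Set where
  field
    xmin xmax ymin ymax zmin zmax : ℤ
open Cuboid public

_∈C_ : Point → Cuboid → Set
(x , y , z) ∈C c =
  (xmin c ≤ x × x ≤ xmax c) × (ymin c ≤ y × y ≤ ymax c) × (zmin c ≤ z × z ≤ zmax c)

NonTrivial : Cuboid → Set
NonTrivial c = ∃ λ (P : Point) → ∃ λ (Q : Point) → P ∈C c × Q ∈C c × ¬ (P ≡ Q)

Consecutive : Cuboid → Cuboid → Set
Consecutive c d =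
  ((xmin c ≤ xmin d × ymin c ≤ ymin d × zmin c ≤ zmin d)
    × (xmin c < xmin d ⊎ ymin c < ymin d ⊎ zmin c < zmin d))
  × (xmin d ≤ xmax c × ymin d ≤ ymax c × zmin d ≤ zmax c)
  × ((xmax c ≤ xmax d × ymax c ≤ ymax d × zmax c ≤ zmax d)
    × (xmax c < xmax d ⊎ ymax c < ymax d ⊎ zmax c < zmax d))

Chain : List Cuboid → Set
Chain (c ∷ d ∷ cs) = Consecutive c d × Chain (d ∷ cs)
Chain _ = ⊤

Regular : List Cuboid → Set
Regular [] = ⊥
Regular (c ∷ cs) =
  All NonTrivial (c ∷ cs)
  × (xmin c ≡ 0ℤ × ymin c ≡ 0ℤ × zmin c ≡ 0ℤ)
  × Chain (c ∷ cs)

_∈S_ : Point → List Cuboid → Set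
P ∈S cs = Any (P ∈C_) cs

IsMaxPoint : List Cuboid → Point → Set
IsMaxPoint cs P = (k : Coord) →
  ((Q : Point) → Q ∈S cs → coord k Q ≤ coord k P)
  × ∃ λ (Q : Point) → Q ∈S cs × coord k Q ≡ coord k P

-- Run cs u v w Q L : running the boundary tracing algorithm on staircase cs with search
-- order (u,v,w), where Q is the current (already recorded) point, L is the list of points
-- recorded from Q onwards, in recording order (Q first, (0,0,0) last).
-- The loop step is taken first; the stop test is applied to the newly recorded point.
data Run (cs : List Cuboid) (u v w : Coord) : Point → List Point → Set where
  stop : ∀ {Q} → dec u Q ≡ origin → dec u Q ∈S cs →
         Run cs u v w Q (Q ∷ origin ∷ [])
  stepU : ∀ {Q L} → dec u Q ∈S cs → ¬ (dec u Q ≡ origin) →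
          Run cs u v w (dec u Q) L → Run cs u v w Q (Q ∷ L)
  stopV : ∀ {Q} → ¬ (dec u Q ∈S cs) → dec v Q ∈S cs → dec v Q ≡ origin →
          Run cs u v w Q (Q ∷ origin ∷ [])
  stepV : ∀ {Q L} → ¬ (dec u Q ∈S cs) → dec v Q ∈S cs → ¬ (dec v Q ≡ origin) →
          Run cs u v w (dec v Q) L → Run cs u v w Q (Q ∷ L)
  stopW : ∀ {Q} → ¬ (dec u Q ∈S cs) → ¬ (dec v Q ∈S cs) → dec w Q ≡ origin →
          Run cs u v w Q (Q ∷ origin ∷ [])
  stepW : ∀ {Q L} → ¬ (dec u Q ∈S cs) → ¬ (dec v Q ∈S cs) → ¬ (dec w Q ≡ origin) →
          Run cs u v w (dec w Q) L → Run cs u v w Q (Q ∷ L)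

_∈Join_ : Point → (List Point × List Point × List Point) → Set
A ∈Join (BX , BY , BZ) =
  ∃ λ A1 → ∃ λ A2 → ∃ λ A3 → A1 ∈ BX × A2 ∈ BY × A3 ∈ BZ × A ≡ (A1 ∪ₚ A2) ∪ₚ A3

module Submission where

-- A staircase is closed under ∪ₚ and has a descent property: if M, Q ∈ 𝒞 and M is below
-- Q in some coordinate, then Q can be decreased by 1 in a coordinate where M is below Q
-- without leaving 𝒞.  For the search order (u, v, w) this says that the tracer only
-- decreases w at the minimum (in u and v) of the current w-layer of 𝒞, so the trace from
-- the maximum point contains, for every A ∈ 𝒞, a point B ≤ A with the same w-coordinate.
-- Taking w = x, y, z gives three such points whose union is A; conversely every such union
-- lies in 𝒞 by ∪ₚ-closure.

open import Defs
open import Data.Integer using (ℤ; _≤_; _<_; _-_; _⊔_; 0ℤ; 1ℤ; -1ℤ; +_; _+_; pred; _<?_; _≟_; ∣_∣)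
open import Data.Integer.Properties
open import Data.Nat using (ℕ; zero; suc)
open import Data.List using (List; []; _∷_)
open import Data.List.Relation.Unary.Any using (Any; here; there; any?)
import Data.List.Relation.Unary.Any as Any
open import Data.List.Relation.Unary.All using (All; []; _∷_)
import Data.List.Relation.Unary.All as All
open import Data.List.Membership.Propositional using (_∈_)
open import Data.Product using (_×_; _,_; ∃; Σ; proj₁; proj₂; -,_; map₂)
open import Data.Product.Properties using (≡-dec)
open import Data.Sum using (_⊎_; inj₁; inj₂)
open import Function using (_∘_)
open import Function.Bundles using (_⇔_; mk⇔)
open import Relation.Nullary using (¬_; Dec; yes; no; contradiction)
open import Relation.Nullary.Decidable using (_×-dec_)
open import Relation.Binary.PropositionalEquality

all-or-some : {F G : Coord → Set} → (∀ k → F k ⊎ G k) → (∀ k → F k) ⊎ Σ Coord G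
all-or-some f with f X | f Y | f Z
... | inj₂ g | _      | _      = inj₂ (X , g)
... | _      | inj₂ g | _      = inj₂ (Y , g)
... | _      | _      | inj₂ g = inj₂ (Z , g)
... | inj₁ a | inj₁ b | inj₁ c = inj₁ λ { X → a ; Y → b ; Z → c }

coord-dec : ∀ k P → coord k (dec k P) ≡ pred (coord k P)
coord-dec X (x , _ , _) = +-comm x -1ℤ
coord-dec Y (_ , y , _) = +-comm y -1ℤ
coord-dec Z (_ , _ , z) = +-comm z -1ℤ

coord-dec-≢ : ∀ {j k} → j ≢ k → ∀ P → coord k (dec j P) ≡ coord k P
coord-dec-≢ {X} {X} j≢k _ = contradiction refl j≢k
coord-dec-≢ {Y} {Y} j≢k _ = contradiction refl j≢k
coord-dec-≢ {Z} {Z} j≢k _ = contradiction refl j≢k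
coord-dec-≢ {X} {Y} _ (_ , _ , _) = refl
coord-dec-≢ {X} {Z} _ (_ , _ , _) = refl
coord-dec-≢ {Y} {X} _ (_ , _ , _) = refl
coord-dec-≢ {Y} {Z} _ (_ , _ , _) = refl
coord-dec-≢ {Z} {X} _ (_ , _ , _) = refl
coord-dec-≢ {Z} {Y} _ (_ , _ , _) = refl

≤-dec-split : ∀ k {A Q} → coord k A ≤ coord k Q →
  coord k A ≡ coord k Q ⊎ coord k A ≤ coord k (dec k Q)
≤-dec-split k {A} {Q} A≤Q with coord k A ≟ coord k Q
... | yes same = inj₁ same
... | no differ =
  inj₂ (subst (coord k A ≤_) (sym (coord-dec k Q)) (i<j⇒i≤pred[j] (≤∧≢⇒< A≤Q differ)))

infix 4 _≤ₚ_

_≤ₚ_ : Point → Point → Set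
A ≤ₚ B = ∀ k → coord k A ≤ coord k B

≤ₚ-trans : ∀ {A B C} → A ≤ₚ B → B ≤ₚ C → A ≤ₚ C
≤ₚ-trans A≤B B≤C k = ≤-trans (A≤B k) (B≤C k)

≤ₚ-antisym : ∀ {A B} → A ≤ₚ B → B ≤ₚ A → A ≡ B
≤ₚ-antisym {_ , _ , _} {_ , _ , _} A≤B B≤A =
  cong₂ _,_ (≤-antisym (A≤B X) (B≤A X))
            (cong₂ _,_ (≤-antisym (A≤B Y) (B≤A Y)) (≤-antisym (A≤B Z) (B≤A Z)))

≤ₚ-≢⇒< : ∀ {A B} → A ≤ₚ B → A ≢ B → Σ Coord λ k → coord k A < coord k B
≤ₚ-≢⇒< {A} {B} A≤B A≢B with all-or-some compare
  where
  compare : ∀ k → coord k B ≤ coord k A ⊎ coord k A < coord k B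
  compare k with coord k A <? coord k B
  ... | yes A<B = inj₂ A<B
  ... | no A≮B = inj₁ (≮⇒≥ A≮B)
... | inj₁ B≤A = contradiction (≤ₚ-antisym A≤B B≤A) A≢B
... | inj₂ strict = strict

coord-∪ₚ : ∀ k A B → coord k (A ∪ₚ B) ≡ coord k A ⊔ coord k B
coord-∪ₚ X (_ , _ , _) (_ , _ , _) = refl
coord-∪ₚ Y (_ , _ , _) (_ , _ , _) = refl
coord-∪ₚ Z (_ , _ , _) (_ , _ , _) = refl

∪ₚ-comm : ∀ A B → A ∪ₚ B ≡ B ∪ₚ A
∪ₚ-comm (x , y , z) (x' , y' , z') = cong₂ _,_ (⊔-comm x x') (cong₂ _,_ (⊔-comm y y') (⊔-comm z z'))

∪ₚ-upperˡ : ∀ A B → A ≤ₚ A ∪ₚ B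
∪ₚ-upperˡ A B k = subst (coord k A ≤_) (sym (coord-∪ₚ k A B)) (i≤i⊔j _ _)

∪ₚ-upperʳ : ∀ A B → B ≤ₚ A ∪ₚ B
∪ₚ-upperʳ A B k = subst (coord k B ≤_) (sym (coord-∪ₚ k A B)) (i≤j⊔i _ _)

∪ₚ-lub : ∀ {A B C} → A ≤ₚ C → B ≤ₚ C → A ∪ₚ B ≤ₚ C
∪ₚ-lub {A} {B} A≤C B≤C k = subst (_≤ _) (sym (coord-∪ₚ k A B)) (⊔-lub (A≤C k) (B≤C k))

∪ₚ-exact : ∀ {A B₁ B₂ B₃} → B₁ ≤ₚ A → B₂ ≤ₚ A → B₃ ≤ₚ A →
  coord X B₁ ≡ coord X A → coord Y B₂ ≡ coord Y A → coord Z B₃ ≡ coord Z A →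
  (B₁ ∪ₚ B₂) ∪ₚ B₃ ≡ A
∪ₚ-exact {A} {B₁} {B₂} {B₃} B₁≤A B₂≤A B₃≤A x₁ y₂ z₃ =
  ≤ₚ-antisym (∪ₚ-lub (∪ₚ-lub B₁≤A B₂≤A) B₃≤A) attained
  where
  U = (B₁ ∪ₚ B₂) ∪ₚ B₃
  reaches : ∀ k {B} → coord k B ≡ coord k A → B ≤ₚ U → coord k A ≤ coord k U
  reaches k same B≤U = ≤-trans (≤-reflexive (sym same)) (B≤U k)
  attained : A ≤ₚ U
  attained X = reaches X x₁ (≤ₚ-trans (∪ₚ-upperˡ B₁ B₂) (∪ₚ-upperˡ _ B₃))
  attained Y = reaches Y y₂ (≤ₚ-trans (∪ₚ-upperʳ B₁ B₂) (∪ₚ-upperˡ _ B₃))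
  attained Z = reaches Z z₃ (∪ₚ-upperʳ _ B₃)

_≟ₚ_ : (A B : Point) → Dec (A ≡ B)
_≟ₚ_ = ≡-dec _≟_ (≡-dec _≟_ _≟_)

low high : Cuboid → Point
low c = xmin c , ymin c , zmin c
high c = xmax c , ymax c , zmax c

∈C⇒bounds : ∀ {P c} → P ∈C c → low c ≤ₚ P × P ≤ₚ high c
∈C⇒bounds {_ , _ , _} ((x₀ , x₁) , (y₀ , y₁) , (z₀ , z₁)) =
  (λ { X → x₀ ; Y → y₀ ; Z → z₀ }) , (λ { X → x₁ ; Y → y₁ ; Z → z₁ })

bounds⇒∈C : ∀ {P c} → low c ≤ₚ P → P ≤ₚ high c → P ∈C c
bounds⇒∈C {_ , _ , _} l≤P P≤h = (l≤P X , P≤h X) , (l≤P Y , P≤h Y) , (l≤P Z , P≤h Z)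

low-∈C : ∀ {P c} → P ∈C c → low c ∈C c
low-∈C p = bounds⇒∈C (λ _ → ≤-refl) (≤ₚ-trans (proj₁ (∈C⇒bounds p)) (proj₂ (∈C⇒bounds p)))

-1-within : ∀ {a x b} → a < x → x ≤ b → a ≤ x - 1ℤ × x - 1ℤ ≤ b
-1-within {x = x} a<x x≤b rewrite +-comm x -1ℤ = i<j⇒i≤pred[j] a<x , i≤j⇒pred[i]≤j x≤b

dec-∈C : ∀ k {P c} → P ∈C c → coord k (low c) < coord k P → dec k P ∈C c
dec-∈C X {_ , _ , _} ((_ , x≤) , ry , rz) l<x = -1-within l<x x≤ , ry , rz
dec-∈C Y {_ , _ , _} (rx , (_ , y≤) , rz) l<y = rx , -1-within l<y y≤ , rz
dec-∈C Z {_ , _ , _} (rx , ry , (_ , z≤)) l<z = rx , ry , -1-within l<z z≤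

_≼_ : Cuboid → Cuboid → Set
c ≼ d = low c ≤ₚ low d × high c ≤ₚ high d

≼-refl : ∀ {c} → c ≼ c
≼-refl = (λ _ → ≤-refl) , (λ _ → ≤-refl)

≼-trans : ∀ {c d e} → c ≼ d → d ≼ e → c ≼ e
≼-trans (l₁ , h₁) (l₂ , h₂) = ≤ₚ-trans l₁ l₂ , ≤ₚ-trans h₁ h₂

consecutive⇒≼ : ∀ {c d} → Consecutive c d → c ≼ d
consecutive⇒≼ (((x₀ , y₀ , z₀) , _) , _ , ((x₁ , y₁ , z₁) , _)) =
  (λ { X → x₀ ; Y → y₀ ; Z → z₀ }) , (λ { X → x₁ ; Y → y₁ ; Z → z₁ })

consecutive-overlap : ∀ {c d} → Consecutive c d → low d ≤ₚ high c
consecutive-overlap (_ , (x , y , z) , _) = λ { X → x ; Y → y ; Z → z }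

∪ₚ-∈C : ∀ {A B c d} → c ≼ d → A ∈C c → B ∈C d → (A ∪ₚ B) ∈C d
∪ₚ-∈C {A} {B} (_ , hc≤hd) a b =
  bounds⇒∈C (≤ₚ-trans (proj₁ (∈C⇒bounds b)) (∪ₚ-upperʳ A B))
            (∪ₚ-lub (≤ₚ-trans (proj₂ (∈C⇒bounds a)) hc≤hd) (proj₂ (∈C⇒bounds b)))

∈S-later : ∀ {P c ds} → Chain (c ∷ ds) → P ∈S (c ∷ ds) → Any (λ d → c ≼ d × P ∈C d) (c ∷ ds)
∈S-later _ (here p) = here (≼-refl , p)
∈S-later {ds = _ ∷ _} (cd , ch) (there p) =
  there (Any.map (λ { (d≼e , q) → ≼-trans (consecutive⇒≼ cd) d≼e , q }) (∈S-later ch p))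

low-≤ₚ : ∀ {P c ds} → Chain (c ∷ ds) → P ∈S (c ∷ ds) → low c ≤ₚ P
low-≤ₚ ch p = lower (∈S-later ch p)
  where
  lower : ∀ {c es P} → Any (λ d → c ≼ d × P ∈C d) es → low c ≤ₚ P
  lower (here (c≼d , p)) = ≤ₚ-trans (proj₁ c≼d) (proj₁ (∈C⇒bounds p))
  lower (there q) = lower q

∪ₚ-∈S : ∀ {A B c ds} → Chain (c ∷ ds) → A ∈S (c ∷ ds) → B ∈S (c ∷ ds) →
  (A ∪ₚ B) ∈S (c ∷ ds)
∪ₚ-∈S ch (here a) b = Any.map (λ { (c≼d , b) → ∪ₚ-∈C c≼d a b }) (∈S-later ch b)
∪ₚ-∈S {A} {B} ch (there a) (here b) =
  subst (_∈S _) (∪ₚ-comm B A) (Any.map (λ { (c≼d , a) → ∪ₚ-∈C c≼d b a }) (∈S-later ch (there a)))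
∪ₚ-∈S {ds = _ ∷ _} (_ , ch) (there a) (there b) = there (∪ₚ-∈S ch a b)

Descent : Point → Point → List Cuboid → Set
Descent M Q cs = Σ Coord λ k → coord k M < coord k Q × dec k Q ∈S cs

step-or-below : ∀ {c d M Q} → Consecutive c d → M ≤ₚ high c → Q ∈C d → ∀ k →
  coord k Q ≤ coord k (high c) ⊎ (coord k M < coord k Q × dec k Q ∈C d)
step-or-below {c} {d} {M} {Q} cd M≤h q k with coord k M <? coord k Q | coord k (low d) <? coord k Q
... | yes M<Q | yes l<Q = inj₂ (M<Q , dec-∈C k q l<Q)
... | no M≮Q  | _       = inj₁ (≤-trans (≮⇒≥ M≮Q) (M≤h k))
... | yes _   | no l≮Q  = inj₁ (≤-trans (≮⇒≥ l≮Q) (consecutive-overlap cd k))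

-- If Q cannot descend towards M inside its own cuboid d, then every coordinate of Q is at
-- the floor of d or not above M; either way it fits under the ceiling of the previous
-- cuboid, so Q already lies there.
climb-down : ∀ {M Q c ds} → Chain (c ∷ ds) → M ≤ₚ high c → Q ∈S (c ∷ ds) →
  Q ∈C c ⊎ Descent M Q (c ∷ ds)
climb-down _ _ (here q) = inj₁ q
climb-down {ds = _ ∷ _} (cd , ch) M≤h (there q)
  with climb-down ch (≤ₚ-trans M≤h (proj₂ (consecutive⇒≼ cd))) q
... | inj₂ descent = inj₂ (map₂ (map₂ there) descent)
... | inj₁ q∈d with all-or-some (step-or-below cd M≤h q∈d)
...   | inj₁ Q≤h =
  inj₁ (bounds⇒∈C (≤ₚ-trans (proj₁ (consecutive⇒≼ cd)) (proj₁ (∈C⇒bounds q∈d))) Q≤h)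
...   | inj₂ (k , M<Q , d∈d) = inj₂ (k , M<Q , there (here d∈d))

descent : ∀ {M Q c ds} → Chain (c ∷ ds) → Q ∈S (c ∷ ds) → M ∈S (c ∷ ds) →
  ∀ j → coord j M < coord j Q → Descent M Q (c ∷ ds)
descent ch (here q) m j M<Q = j , M<Q , here (dec-∈C j q (≤-<-trans (low-≤ₚ ch m j) M<Q))
descent ch (there q) (here m) j M<Q with climb-down ch (proj₂ (∈C⇒bounds m)) (there q)
... | inj₁ q∈c = j , M<Q , here (dec-∈C j q∈c (≤-<-trans (proj₁ (∈C⇒bounds m) j) M<Q))
... | inj₂ d = d
descent {ds = _ ∷ _} (_ , ch) (there q) (there m) j M<Q = map₂ (map₂ there) (descent ch q m j M<Q)

low≡origin : ∀ {c} → xmin c ≡ 0ℤ × ymin c ≡ 0ℤ × zmin c ≡ 0ℤ → low c ≡ origin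
low≡origin (x₀ , y₀ , z₀) = cong₂ _,_ x₀ (cong₂ _,_ y₀ z₀)

∈S-nonneg : ∀ {A c ds} → Regular (c ∷ ds) → A ∈S (c ∷ ds) → origin ≤ₚ A
∈S-nonneg {A} {c} (_ , zeros , ch) a = subst (_≤ₚ A) (low≡origin {c} zeros) (low-≤ₚ ch a)

origin-∈S : ∀ {c ds} → Regular (c ∷ ds) → origin ∈S (c ∷ ds)
origin-∈S {c} ((_ , _ , p , _) ∷ _ , zeros , _) = here (subst (_∈C c) (low≡origin {c} zeros) (low-∈C p))

_∈S?_ : (P : Point) (cs : List Cuboid) → Dec (P ∈S cs)
(x , y , z) ∈S? cs = any? membership cs
  where
  membership : (c : Cuboid) → Dec ((x , y , z) ∈C c)
  membership c = ((xmin c ≤? x) ×-dec (x ≤? xmax c)) ×-dec ((ymin c ≤? y) ×-dec (y ≤? ymax c))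
                   ×-dec ((zmin c ≤? z) ×-dec (z ≤? zmax c))

coordSum : Point → ℤ
coordSum (x , y , z) = x + y + z

coordSum-nonneg : ∀ {P} → origin ≤ₚ P → 0ℤ ≤ coordSum P
coordSum-nonneg 0≤P = +-mono-≤ (+-mono-≤ (0≤P X) (0≤P Y)) (0≤P Z)

coordSum-dec : ∀ k P → coordSum (dec k P) ≡ pred (coordSum P)
coordSum-dec X (x , y , z) rewrite +-comm x -1ℤ = trans (cong (_+ z) (pred-+ x y)) (pred-+ (x + y) z)
coordSum-dec Y (x , y , z) rewrite +-comm y -1ℤ = trans (cong (_+ z) (+-pred x y)) (pred-+ (x + y) z)
coordSum-dec Z (x , y , z) rewrite +-comm z -1ℤ = +-pred (x + y) z

record SearchOrder (u v w : Coord) : Set where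
  field
    u≢w : u ≢ w
    v≢w : v ≢ w
    cover : ∀ k → k ≡ u ⊎ k ≡ v ⊎ k ≡ w

xyz : SearchOrder X Y Z
xyz = record { u≢w = λ () ; v≢w = λ ()
             ; cover = λ { X → inj₁ refl ; Y → inj₂ (inj₁ refl) ; Z → inj₂ (inj₂ refl) } }

yzx : SearchOrder Y Z X
yzx = record { u≢w = λ () ; v≢w = λ ()
             ; cover = λ { Y → inj₁ refl ; Z → inj₂ (inj₁ refl) ; X → inj₂ (inj₂ refl) } }

zxy : SearchOrder Z X Y
zxy = record { u≢w = λ () ; v≢w = λ ()
             ; cover = λ { Z → inj₁ refl ; X → inj₂ (inj₁ refl) ; Y → inj₂ (inj₂ refl) } }

record LayerMinorant (w : Coord) (L : List Point) (A : Point) : Set where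
  constructor minorant
  field
    {point} : Point
    recorded : point ∈ L
    below : point ≤ₚ A
    level : coord w point ≡ coord w A

minorant-∷ : ∀ {w L A Q} → LayerMinorant w L A → LayerMinorant w (Q ∷ L) A
minorant-∷ (minorant B∈L B≤A level) = minorant (there B∈L) B≤A level

module Tracing {u v w : Coord} (order : SearchOrder u v w) {c : Cuboid} {ds : List Cuboid}
               (reg : Regular (c ∷ ds)) where
  open SearchOrder order

  private
    cs : List Cuboid
    cs = c ∷ ds

    ch : Chain cs
    ch = proj₂ (proj₂ reg)

  only-w-descends : ∀ {k Q} → ¬ dec u Q ∈S cs → ¬ dec v Q ∈S cs → dec k Q ∈S cs → k ≡ w
  only-w-descends {k} ¬du ¬dv dk with cover k
  ... | inj₁ refl = contradiction dk ¬du
  ... | inj₂ (inj₁ refl) = contradiction dk ¬dv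
  ... | inj₂ (inj₂ k≡w) = k≡w

  stuck-descends : ∀ {Q} → Q ∈S cs → Q ≢ origin → ¬ dec u Q ∈S cs → ¬ dec v Q ∈S cs →
    dec w Q ∈S cs
  stuck-descends q Q≢o ¬du ¬dv
    with ≤ₚ-≢⇒< (∈S-nonneg reg q) (Q≢o ∘ sym)
  ... | j , 0<Q with descent ch q (origin-∈S reg) j 0<Q
  ...   | k , _ , dk with only-w-descends {k} ¬du ¬dv dk
  ...     | refl = dk

  stuck-is-layer-minimum : ∀ {Q R} → Q ∈S cs → ¬ dec u Q ∈S cs → ¬ dec v Q ∈S cs → R ∈S cs →
    coord w R ≡ coord w Q → Q ≤ₚ R
  stuck-is-layer-minimum {Q} {R} q ¬du ¬dv r same k = ≮⇒≥ (no-descent ∘ descent ch q r k)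
    where
    no-descent : ¬ Descent R Q cs
    no-descent (j , R<Q , dj) with only-w-descends {j} ¬du ¬dv dj
    ... | refl = <-irrefl same R<Q

  -- Each step lowers coordSum by 1 and coordSum is nonnegative on 𝒞, so n bounds the steps left.
  trace : ∀ (n : ℕ) {Q} → Q ∈S cs → Q ≢ origin → coordSum Q ≡ pred (+ n) →
    Σ (List Point) (Run cs u v w Q)
  trace zero q _ sum with subst (0ℤ ≤_) sum (coordSum-nonneg (∈S-nonneg reg q))
  ... | ()
  trace (suc n) {Q} q Q≢o sum with dec u Q ∈S? cs
  ... | yes du with dec u Q ≟ₚ origin
  ...   | yes d≡o = -, stop d≡o du
  ...   | no d≢o = -, stepU du d≢o (proj₂ (trace n du d≢o (trans (coordSum-dec u Q) (cong pred sum))))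
  trace (suc n) {Q} q Q≢o sum | no ¬du with dec v Q ∈S? cs
  ...   | yes dv with dec v Q ≟ₚ origin
  ...     | yes d≡o = -, stopV ¬du dv d≡o
  ...     | no d≢o = -, stepV ¬du dv d≢o (proj₂ (trace n dv d≢o (trans (coordSum-dec v Q) (cong pred sum))))
  trace (suc n) {Q} q Q≢o sum | no ¬du | no ¬dv with dec w Q ≟ₚ origin
  ...     | yes d≡o = -, stopW ¬du ¬dv d≡o
  ...     | no d≢o = -, stepW ¬du ¬dv d≢o (proj₂ (trace n (stuck-descends q Q≢o ¬du ¬dv) d≢o
                                                     (trans (coordSum-dec w Q) (cong pred sum))))

  trace-⊆ : ∀ {Q L} → Q ∈S cs → Q ≢ origin → Run cs u v w Q L → All (_∈S cs) L
  trace-⊆ q _ (stop _ _) = q ∷ origin-∈S reg ∷ []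
  trace-⊆ q _ (stopV _ _ _) = q ∷ origin-∈S reg ∷ []
  trace-⊆ q _ (stopW _ _ _) = q ∷ origin-∈S reg ∷ []
  trace-⊆ q _ (stepU du d≢o r) = q ∷ trace-⊆ du d≢o r
  trace-⊆ q _ (stepV _ dv d≢o r) = q ∷ trace-⊆ dv d≢o r
  trace-⊆ q Q≢o (stepW ¬du ¬dv d≢o r) = q ∷ trace-⊆ (stuck-descends q Q≢o ¬du ¬dv) d≢o r

  origin-minorant : ∀ {A Q} → A ∈S cs → coord w A ≤ coord w origin →
    LayerMinorant w (Q ∷ origin ∷ []) A
  origin-minorant a A≤o =
    minorant (there (here refl)) (∈S-nonneg reg a) (≤-antisym (∈S-nonneg reg a w) A≤o)

  stuck-minorant : ∀ {A Q L} → Q ∈S cs → ¬ dec u Q ∈S cs → ¬ dec v Q ∈S cs → A ∈S cs →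
    coord w A ≡ coord w Q → LayerMinorant w (Q ∷ L) A
  stuck-minorant q ¬du ¬dv a same =
    minorant (here refl) (stuck-is-layer-minimum q ¬du ¬dv a same) (sym same)

  ≤-level-dec : ∀ {j A Q} → j ≢ w → coord w A ≤ coord w Q → coord w A ≤ coord w (dec j Q)
  ≤-level-dec {Q = Q} j≢w A≤Q = subst (_ ≤_) (sym (coord-dec-≢ j≢w Q)) A≤Q

  trace-minorant : ∀ {A Q L} → Q ∈S cs → Q ≢ origin → Run cs u v w Q L → A ∈S cs →
    coord w A ≤ coord w Q → LayerMinorant w L A
  trace-minorant {A} _ _ (stop d≡o _) a A≤Q =
    origin-minorant a (subst (λ D → coord w A ≤ coord w D) d≡o (≤-level-dec u≢w A≤Q))
  trace-minorant {A} _ _ (stopV _ _ d≡o) a A≤Q =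
    origin-minorant a (subst (λ D → coord w A ≤ coord w D) d≡o (≤-level-dec v≢w A≤Q))
  trace-minorant _ _ (stepU du d≢o r) a A≤Q =
    minorant-∷ (trace-minorant du d≢o r a (≤-level-dec u≢w A≤Q))
  trace-minorant _ _ (stepV _ dv d≢o r) a A≤Q =
    minorant-∷ (trace-minorant dv d≢o r a (≤-level-dec v≢w A≤Q))
  trace-minorant {A} q _ (stopW ¬du ¬dv d≡o) a A≤Q with ≤-dec-split w A≤Q
  ... | inj₁ same = stuck-minorant q ¬du ¬dv a same
  ... | inj₂ A≤D = origin-minorant a (subst (λ D → coord w A ≤ coord w D) d≡o A≤D)
  trace-minorant q Q≢o (stepW ¬du ¬dv d≢o r) a A≤Q with ≤-dec-split w A≤Q
  ... | inj₁ same = stuck-minorant q ¬du ¬dv a same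
  ... | inj₂ A≤D = minorant-∷ (trace-minorant (stuck-descends q Q≢o ¬du ¬dv) d≢o r a A≤D)

  traced : ∀ {P} → P ∈S cs → P ≢ origin →
    Σ (List Point) λ L → Run cs u v w P L × All (_∈S cs) L
                       × (∀ {A} → A ∈S cs → A ≤ₚ P → LayerMinorant w L A)
  traced {P} p P≢o with trace (suc ∣ coordSum P ∣) p P≢o start
    where
    start : coordSum P ≡ pred (+ suc ∣ coordSum P ∣)
    start = sym (0≤i⇒+∣i∣≡i (coordSum-nonneg (∈S-nonneg reg p)))
  ... | L , run = L , run , trace-⊆ p P≢o run , λ a A≤P → trace-minorant p P≢o run a (A≤P w)

maxPoint-∈S : ∀ {P c ds} → Chain (c ∷ ds) → IsMaxPoint (c ∷ ds) P → P ∈S (c ∷ ds)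
maxPoint-∈S {P} ch max with max X | max Y | max Z
... | _ , _ , qx , x≡ | _ , _ , qy , y≡ | _ , _ , qz , z≡ =
  subst (_∈S _) (∪ₚ-exact (bound qx) (bound qy) (bound qz) x≡ y≡ z≡)
                (∪ₚ-∈S ch (∪ₚ-∈S ch qx qy) qz)
  where
  bound : ∀ {Q} → Q ∈S _ → Q ≤ₚ P
  bound q k = proj₁ (max k) _ q

-- Otherwise every point of 𝒞 would be squeezed between origin and P = origin, but C₁ has two.
maxPoint-≢-origin : ∀ {P c ds} → Regular (c ∷ ds) → IsMaxPoint (c ∷ ds) P → P ≢ origin
maxPoint-≢-origin reg@((_ , _ , a , b , A≢B) ∷ _ , _) max refl =
  A≢B (trans (squeezed (here a)) (sym (squeezed (here b))))
  where
  squeezed : ∀ {Q} → Q ∈S _ → Q ≡ origin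
  squeezed q = ≤ₚ-antisym (λ k → proj₁ (max k) _ q) (∈S-nonneg reg q)

minorants-∈Join : ∀ {A BX BY BZ} →
  LayerMinorant X BX A → LayerMinorant Y BY A → LayerMinorant Z BZ A → A ∈Join (BX , BY , BZ)
minorants-∈Join (minorant b₁ B₁≤A x₁) (minorant b₂ B₂≤A y₂) (minorant b₃ B₃≤A z₃) =
  -, -, -, b₁ , b₂ , b₃ , sym (∪ₚ-exact B₁≤A B₂≤A B₃≤A x₁ y₂ z₃)

∈Join-∈S : ∀ {A BX BY BZ c ds} → Chain (c ∷ ds) →
  All (_∈S (c ∷ ds)) BX → All (_∈S (c ∷ ds)) BY → All (_∈S (c ∷ ds)) BZ →
  A ∈Join (BX , BY , BZ) → A ∈S (c ∷ ds)
∈Join-∈S ch BX⊆ BY⊆ BZ⊆ (_ , _ , _ , b₁ , b₂ , b₃ , A≡) =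
  subst (_∈S _) (sym A≡)
    (∪ₚ-∈S ch (∪ₚ-∈S ch (All.lookup BX⊆ b₁) (All.lookup BY⊆ b₂)) (All.lookup BZ⊆ b₃))

theorem2 : (cs : List Cuboid) → Regular cs → (P : Point) → IsMaxPoint cs P →
    ∃ λ (BZ : List Point) → ∃ λ (BX : List Point) → ∃ λ (BY : List Point) →
      Run cs X Y Z P BZ × Run cs Y Z X P BX × Run cs Z X Y P BY
      × ((A : Point) → (A ∈S cs) ⇔ (A ∈Join (BX , BY , BZ)))
theorem2 [] () P max
theorem2 (c ∷ ds) reg@(_ , _ , ch) P max
  with Tracing.traced yzx reg p∈ P≢o | Tracing.traced zxy reg p∈ P≢o | Tracing.traced xyz reg p∈ P≢o
  where
  p∈ : P ∈S (c ∷ ds)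
  p∈ = maxPoint-∈S ch max
  P≢o : P ≢ origin
  P≢o = maxPoint-≢-origin reg max
... | BX , runX , BX⊆ , minX | BY , runY , BY⊆ , minY | BZ , runZ , BZ⊆ , minZ =
  BZ , BX , BY , runZ , runX , runY , λ A → mk⇔
    (λ a → minorants-∈Join (minX a (bound a)) (minY a (bound a)) (minZ a (bound a)))
    (∈Join-∈S ch BX⊆ BY⊆ BZ⊆)
  where
  bound : ∀ {A} → A ∈S (c ∷ ds) → A ≤ₚ P
  bound a k = proj₁ (max k) _ a
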